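{- Let $n\ge 3$ and let $Q^+(2n+1,2)$ be a non-degenerate hyperbolic quadric of ${\rm PG}(2n+1,2)$. Let $NO^+(2n+2,2)$ be the graph with vertex set ${\rm PG}(2n+1,2)\setminus Q^+(2n+1,2)$, two vertices adjacent iff the line joining them is tangent to $Q^+(2n+1,2)$. Fix a generator $\Pi$ of $Q^+(2n+1,2)$ and let $\mathcal G_n$ be the graph with vertex set $Q^+(2n+1,2)\setminus\Pi$, two distinct vertices $P_1,P_2$ adjacent iff either the line $\langle P_1,P_2\rangle$ is secant to $Q^+(2n+1,2)$, or it is contained in $Q^+(2n+1,2)$ and meets $\Pi$ in a point. Then $\mathcal G_n$ and $NO^+(2n+2,2)$ are not isomorphic.
   Context: A generator of $Q^+(2n+1,2)$ is an $n$-dimensional projective subspace contained in the quadric. A tangent line is a line meeting the quadric in exactly one point. -}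

module Defs where

open import Data.Bool using (Bool; true; false; _∧_; _∨_; not; _xor_)
open import Data.Nat using (ℕ; zero; suc; _+_; _*_)
open import Data.Fin using (Fin; zero; suc)
open import Data.Vec using (Vec; zipWith; map; replicate; lookup; foldr; _∷_; [])
open import Data.List using (List; length; filter; _∷_; [])
open import Data.Product using (Σ; ∃; _×_; _,_; proj₁)
open import Relation.Binary.PropositionalEquality using (_≡_; _≢_)
open import Relation.Nullary using (¬_)
open import Data.Bool.Properties using (T?)
open import Function.Bundles using (_⤖_; Bijection)

-- Vectors of F₂^m (F₂ = Bool, addition = xor, multiplication = ∧).
V : ℕ → Set
V m = Vec Bool m

_⊕_ : ∀ {m} → V m → V m → V m
_⊕_ = zipWith _xor_

zeroV : ∀ {m} → V m
zeroV = replicate _ false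

-- x is a nonzero vector (so represents a point of PG(m-1,2))
nz : ∀ {m} → V m → Bool
nz = foldr _ _∨_ false

xorSum : ∀ {k} → (Fin k → Bool) → Bool
xorSum {zero} f = false
xorSum {suc k} f = f zero xor xorSum (λ i → f (suc i))

vsum : ∀ {m k} → (Fin k → V m) → V m
vsum {m} {zero} f = zeroV
vsum {m} {suc k} f = f zero ⊕ vsum (λ i → f (suc i))

scale : ∀ {m} → Bool → V m → V m
scale b = map (b ∧_)

comb : ∀ {m k} → (Fin k → V m) → V k → V m
comb g c = vsum (λ i → scale (lookup c i) (g i))

-- A quadratic form on F₂^m, given by a coefficient matrix A:
-- Q(x) = Σ_{i,j} A_ij x_i x_j  (every quadratic form over F₂ arises this way)
QForm : ℕ → Set
QForm m = Fin m → Fin m → Bool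

evalQ : ∀ {m} → QForm m → V m → Bool
evalQ A x = xorSum (λ i → xorSum (λ j → A i j ∧ (lookup x i ∧ lookup x j)))

polar : ∀ {m} → QForm m → V m → V m → Bool
polar A x y = evalQ A (x ⊕ y) xor (evalQ A x xor evalQ A y)

-- non-degenerate: polar form has trivial radical (m even here, so this is
-- non-degeneracy of the quadric)
NonDegenerate : ∀ {m} → QForm m → Set
NonDegenerate {m} A = ∀ (x : V m) → nz x ≡ true → ∃ λ y → polar A x y ≡ true

onQ : ∀ {m} → QForm m → V m → Bool
onQ A x = nz x ∧ not (evalQ A x)

-- the line through two distinct points x, y of PG(m-1,2) is {x, y, x+y}
line : ∀ {m} → V m → V m → List (V m)
line x y = x ∷ y ∷ (x ⊕ y) ∷ []

countB : ∀ {m} → (V m → Bool) → List (V m) → ℕ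
countB p xs = length (filter (λ v → T? (p v)) xs)

lineMeetsQ : ∀ {m} → QForm m → V m → V m → ℕ
lineMeetsQ A x y = countB (onQ A) (line x y)

Tangent Secant ContainedInQ : ∀ {m} → QForm m → V m → V m → Set
Tangent A x y = lineMeetsQ A x y ≡ 1
Secant A x y = lineMeetsQ A x y ≡ 2
ContainedInQ A x y = lineMeetsQ A x y ≡ 3

-- A generator of the quadric: an n-dimensional projective subspace, i.e. the
-- span of n+1 linearly independent vectors, contained in the quadric.
record Generator (n : ℕ) {m : ℕ} (A : QForm m) : Set where
  field
    π      : V m → Bool
    basis  : Fin (suc n) → V m
    indep  : ∀ (c : V (suc n)) → nz c ≡ true → nz (comb basis c) ≡ true
    span   : ∀ (x : V m) → (π x ≡ true → ∃ λ c → comb basis c ≡ x)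
                          × ((∃ λ c → comb basis c ≡ x) → π x ≡ true)
    inQ    : ∀ (c : V (suc n)) → evalQ A (comb basis c) ≡ false

NOVert : ∀ {m} → QForm m → Set
NOVert {m} A = Σ (V m) λ x → (nz x ∧ not (onQ A x)) ≡ true

NOAdj : ∀ {m} (A : QForm m) → NOVert A → NOVert A → Set
NOAdj A (x , _) (y , _) = x ≢ y × Tangent A x y

GVert : ∀ {n m} (A : QForm m) → Generator n A → Set
GVert {n} {m} A Π = Σ (V m) λ x → (onQ A x ∧ not (Generator.π Π x)) ≡ true

GAdj : ∀ {n m} (A : QForm m) (Π : Generator n A) → GVert A Π → GVert A Π → Set
GAdj A Π (x , _) (y , _) =
  x ≢ y × (Secant A x y ⊎' (ContainedInQ A x y × countB (Generator.π Π) (line x y) ≡ 1))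
  where
  open import Data.Sum using () renaming (_⊎_ to _⊎'_)

Isomorphic : ∀ {V₁ V₂ : Set} → (V₁ → V₁ → Set) → (V₂ → V₂ → Set) → Set
Isomorphic {V₁} {V₂} E₁ E₂ =
  Σ (V₁ ⤖ V₂) λ f → ∀ u v →
    (E₁ u v → E₂ (Bijection.to f u) (Bijection.to f v)) ×
    (E₂ (Bijection.to f u) (Bijection.to f v) → E₁ u v)

{-# OPTIONS --safe #-}

-- A graph invariant separates the two graphs: call a graph completable if every two distinct
-- non-adjacent vertices u, v have a third vertex z, distinct from and non-adjacent to both, that is
-- adjacent to every common neighbour of u and v. Write B for the polar form of the quadric.
-- In NO⁺(2n+2,2) two points off the quadric span a tangent line iff they are B-orthogonal, so
-- z = u + v, the third point of the line uv, completes every non-edge.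
-- In 𝒢ₙ pick g₀,…,g₃ ∈ Π and singular f₀,…,f₃ with B(gᵢ,fⱼ) = δᵢⱼ and B(fᵢ,fⱼ) = 0
-- (a basis of Π has a dual family by non-degeneracy, which is then corrected).
-- For u = f₀ and v = f₁ the common neighbours g₁+f₀, g₀+f₁, g₀+g₁+f₂, g₀+g₁+f₃ and g₀+g₁+f₂+f₃
-- force any completing z to have B(z,·) = 1 on g₀, g₁ and on the last three, whose sum is g₀+g₁:
-- a contradiction.
module Submission where

open import Algebra.Bundles using (CommutativeRing)
open import Axiom.UniquenessOfIdentityProofs using (module Decidable⇒UIP)
open import Data.Bool using (Bool; true; false; _∧_; not; _xor_; if_then_else_)
open import Data.Bool.Properties
  using (_≟_; ¬-not; xor-∧-commutativeRing; xor-assoc; xor-comm; xor-identityˡ; xor-identityʳ; xor-same;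
         ∧-comm; ∧-zeroʳ; ∧-identityʳ; ∧-distribˡ-xor; ∧-distribʳ-xor)
open import Algebra.Properties.CommutativeSemigroup (CommutativeRing.+-commutativeSemigroup xor-∧-commutativeRing)
  using () renaming (interchange to xor-interchange)
open import Data.Empty using (⊥)
open import Data.Fin using (Fin; zero; suc; _↑ˡ_)
open import Data.List using (List; _∷_; [])
open import Data.Nat using (ℕ; zero; suc; _+_; _*_; _≤_; s≤s; z≤n)
open import Data.Nat.Properties using (+-identityʳ)
open import Data.Product using (Σ; _×_; _,_; proj₁; proj₂)
open import Data.Sum using (_⊎_; inj₁; inj₂; [_,_])
open import Data.Vec using ([]; _∷_; lookup; tabulate)
open import Data.Vec.Properties
  using (zipWith-assoc; zipWith-comm; zipWith-identityˡ; zipWith-identityʳ; lookup-zipWith; lookup-replicate;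
         map-const; lookup∘tabulate; tabulate∘lookup; tabulate-cong)
open import Function using (_∘_)
open import Function.Bundles using (Bijection; Equivalence; _⇔_; mk⇔)
open import Relation.Binary.PropositionalEquality
  using (_≡_; _≢_; refl; sym; trans; cong; cong₂; subst; module ≡-Reasoning)
open import Relation.Nullary using (¬_; contradiction)

open import Defs

private
  variable
    m k l : ℕ

xor-cancelʳ : ∀ a b → (a xor b) xor b ≡ a
xor-cancelʳ a b = trans (xor-assoc a b b) (trans (cong (a xor_) (xor-same b)) (xor-identityʳ a))

true≢false : true ≢ false
true≢false ()

⊕-assoc : (x y z : V m) → (x ⊕ y) ⊕ z ≡ x ⊕ (y ⊕ z)
⊕-assoc = zipWith-assoc xor-assoc

⊕-comm : (x y : V m) → x ⊕ y ≡ y ⊕ x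
⊕-comm = zipWith-comm xor-comm

⊕-identityˡ : (x : V m) → zeroV ⊕ x ≡ x
⊕-identityˡ = zipWith-identityˡ xor-identityˡ

⊕-identityʳ : (x : V m) → x ⊕ zeroV ≡ x
⊕-identityʳ = zipWith-identityʳ xor-identityʳ

⊕-self : (x : V m) → x ⊕ x ≡ zeroV
⊕-self []      = refl
⊕-self (a ∷ x) = cong₂ _∷_ (xor-same a) (⊕-self x)

⊕-cancelʳ : (x y : V m) → (x ⊕ y) ⊕ y ≡ x
⊕-cancelʳ x y = trans (⊕-assoc x y y) (trans (cong (x ⊕_) (⊕-self y)) (⊕-identityʳ x))

⊕≡zeroV⇒≡ : (x y : V m) → x ⊕ y ≡ zeroV → x ≡ y
⊕≡zeroV⇒≡ x y eq = trans (sym (⊕-cancelʳ x y)) (trans (cong (_⊕ y) eq) (⊕-identityˡ y))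

⊕-interchange : (x y z w : V m) → (x ⊕ y) ⊕ (z ⊕ w) ≡ (x ⊕ z) ⊕ (y ⊕ w)
⊕-interchange []      []      []      []      = refl
⊕-interchange (a ∷ x) (b ∷ y) (c ∷ z) (d ∷ w) =
  cong₂ _∷_ (xor-interchange a b c d) (⊕-interchange x y z w)

⊕-cancelˡ-⊕ : (x y z : V m) → (x ⊕ y) ⊕ (x ⊕ z) ≡ y ⊕ z
⊕-cancelˡ-⊕ x y z =
  trans (⊕-interchange x y x z) (trans (cong (_⊕ (y ⊕ z)) (⊕-self x)) (⊕-identityˡ (y ⊕ z)))

lookup-ext : {x y : V m} → (∀ i → lookup x i ≡ lookup y i) → x ≡ y
lookup-ext {x = x} {y} eq = trans (sym (tabulate∘lookup x)) (trans (tabulate-cong eq) (tabulate∘lookup y))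

lookup-⊕ : (x y : V m) (i : Fin m) → lookup (x ⊕ y) i ≡ lookup x i xor lookup y i
lookup-⊕ x y i = lookup-zipWith _xor_ i x y

scale-true : (x : V m) → scale true x ≡ x
scale-true []      = refl
scale-true (a ∷ x) = cong (a ∷_) (scale-true x)

scale-false : (x : V m) → scale false x ≡ zeroV
scale-false x = map-const x false

scale-xor : (a b : Bool) (x : V m) → scale a x ⊕ scale b x ≡ scale (a xor b) x
scale-xor a b []      = refl
scale-xor a b (c ∷ x) = cong₂ _∷_ (sym (∧-distribʳ-xor c a b)) (scale-xor a b x)

nz≡false⇒≡zeroV : (x : V m) → nz x ≡ false → x ≡ zeroV
nz≡false⇒≡zeroV []          _  = refl
nz≡false⇒≡zeroV (false ∷ x) eq = cong (false ∷_) (nz≡false⇒≡zeroV x eq)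

≢⇒nz-⊕ : {x y : V m} → x ≢ y → nz (x ⊕ y) ≡ true
≢⇒nz-⊕ {x = x} {y} x≢y = ¬-not (x≢y ∘ ⊕≡zeroV⇒≡ x y ∘ nz≡false⇒≡zeroV (x ⊕ y))

xorSum-cong : {f h : Fin k → Bool} → (∀ i → f i ≡ h i) → xorSum f ≡ xorSum h
xorSum-cong {zero}  eq = refl
xorSum-cong {suc k} eq = cong₂ _xor_ (eq zero) (xorSum-cong (eq ∘ suc))

xorSum-xor : (f h : Fin k → Bool) → xorSum (λ i → f i xor h i) ≡ xorSum f xor xorSum h
xorSum-xor {zero}  f h = refl
xorSum-xor {suc k} f h = trans (cong ((f zero xor h zero) xor_) (xorSum-xor (f ∘ suc) (h ∘ suc)))
                               (xor-interchange (f zero) (h zero) _ _)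

xorSum-false : {f : Fin k → Bool} → (∀ i → f i ≡ false) → xorSum f ≡ false
xorSum-false {zero}  eq = refl
xorSum-false {suc k} eq = cong₂ _xor_ (eq zero) (xorSum-false (eq ∘ suc))

_·_ : V k → V k → Bool
x · y = xorSum (λ i → lookup x i ∧ lookup y i)

δ : Fin k → Fin k → Bool
δ zero    zero    = true
δ zero    (suc _) = false
δ (suc _) zero    = false
δ (suc i) (suc j) = δ i j

xorSum-δ : (c : Fin k → Bool) (i : Fin k) → xorSum (λ j → c j ∧ δ i j) ≡ c i
xorSum-δ c zero    = trans (cong₂ _xor_ (∧-identityʳ (c zero)) (xorSum-false (λ j → ∧-zeroʳ (c (suc j)))))
                           (xor-identityʳ (c zero))
xorSum-δ c (suc i) = trans (cong (_xor xorSum (λ j → c (suc j) ∧ δ i j)) (∧-zeroʳ (c zero)))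
                           (xorSum-δ (c ∘ suc) i)

δ-sym : (i j : Fin k) → δ i j ≡ δ j i
δ-sym zero    zero    = refl
δ-sym zero    (suc j) = refl
δ-sym (suc i) zero    = refl
δ-sym (suc i) (suc j) = δ-sym i j

δ-↑ˡ : (i j : Fin k) → δ (i ↑ˡ l) (j ↑ˡ l) ≡ δ i j
δ-↑ˡ zero    zero    = refl
δ-↑ˡ zero    (suc j) = refl
δ-↑ˡ (suc i) zero    = refl
δ-↑ˡ (suc i) (suc j) = δ-↑ˡ i j

lc : (Fin k → V m) → (Fin k → Bool) → V m
lc e c = vsum (λ i → scale (c i) (e i))

lc-cong : (e : Fin k → V m) {c c′ : Fin k → Bool} → (∀ i → c i ≡ c′ i) → lc e c ≡ lc e c′
lc-cong {zero}  e eq = refl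
lc-cong {suc k} e eq = cong₂ (λ a r → scale a (e zero) ⊕ r) (eq zero) (lc-cong (e ∘ suc) (eq ∘ suc))

lc-false : (e : Fin k → V m) {c : Fin k → Bool} → (∀ i → c i ≡ false) → lc e c ≡ zeroV
lc-false {zero}  e eq = refl
lc-false {suc k} e eq = trans (cong₂ _⊕_ (trans (cong (λ a → scale a (e zero)) (eq zero)) (scale-false (e zero)))
                                         (lc-false (e ∘ suc) (eq ∘ suc)))
                              (⊕-identityˡ zeroV)

lc-⊕ : (e : Fin k → V m) (c c′ : Fin k → Bool) → lc e c ⊕ lc e c′ ≡ lc e (λ i → c i xor c′ i)
lc-⊕ {zero}  e c c′ = ⊕-identityˡ zeroV
lc-⊕ {suc k} e c c′ =
  trans (⊕-interchange (scale (c zero) (e zero)) (lc (e ∘ suc) (c ∘ suc))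
                       (scale (c′ zero) (e zero)) (lc (e ∘ suc) (c′ ∘ suc)))
        (cong₂ _⊕_ (scale-xor (c zero) (c′ zero) (e zero)) (lc-⊕ (e ∘ suc) (c ∘ suc) (c′ ∘ suc)))

comb-⊕ : (e : Fin k → V m) (c c′ : V k) → comb e c ⊕ comb e c′ ≡ comb e (c ⊕ c′)
comb-⊕ e c c′ = trans (lc-⊕ e (lookup c) (lookup c′)) (lc-cong e (λ i → sym (lookup-⊕ c c′ i)))

lc-δ : (e : Fin k → V m) (i : Fin k) → lc e (δ i) ≡ e i
lc-δ e zero    = trans (cong₂ _⊕_ (scale-true (e zero)) (lc-false (e ∘ suc) (λ _ → refl)))
                       (⊕-identityʳ (e zero))
lc-δ e (suc i) = trans (cong (_⊕ lc (e ∘ suc) (δ i)) (scale-false (e zero)))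
                       (trans (⊕-identityˡ _) (lc-δ (e ∘ suc) i))

Independent : (Fin k → V m) → Set
Independent {k} e = (c : V k) → nz c ≡ true → nz (comb e c) ≡ true

independent-tail : {e : Fin (suc k) → V m} → Independent e → Independent (e ∘ suc)
independent-tail {e = e} ind c nz-c =
  subst (λ x → nz x ≡ true) (trans (cong (_⊕ comb (e ∘ suc) c) (scale-false (e zero))) (⊕-identityˡ _))
        (ind (false ∷ c) nz-c)

independent-lc : {e : Fin k → V m} → Independent e → ∀ c → nz (tabulate c) ≡ true → nz (lc e c) ≡ true
independent-lc {e = e} ind c nz-c =
  subst (λ x → nz x ≡ true) (lc-cong e (lookup∘tabulate c)) (ind (tabulate c) nz-c)

module QuadraticForm (A : QForm m) where

  Q : V m → Bool
  Q = evalQ A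

  B : V m → V m → Bool
  B = polar A

  -- Q x is β x x by definition, so B x y = β x y xor β y x inherits the bilinearity of β.
  β : V m → V m → Bool
  β x y = xorSum (λ i → xorSum (λ j → A i j ∧ (lookup x i ∧ lookup y j)))

  β-⊕ˡ : (x x′ y : V m) → β (x ⊕ x′) y ≡ β x y xor β x′ y
  β-⊕ˡ x x′ y = trans (xorSum-cong λ i → trans (xorSum-cong (term i)) (xorSum-xor {k = m} _ _))
                      (xorSum-xor {k = m} _ _)
    where
    distrib : ∀ a b c d → a ∧ ((b xor c) ∧ d) ≡ (a ∧ (b ∧ d)) xor (a ∧ (c ∧ d))
    distrib a b c d = trans (cong (a ∧_) (∧-distribʳ-xor d b c)) (∧-distribˡ-xor a (b ∧ d) (c ∧ d))
    term : ∀ i j → A i j ∧ (lookup (x ⊕ x′) i ∧ lookup y j)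
                 ≡ (A i j ∧ (lookup x i ∧ lookup y j)) xor (A i j ∧ (lookup x′ i ∧ lookup y j))
    term i j rewrite lookup-⊕ x x′ i = distrib (A i j) (lookup x i) (lookup x′ i) (lookup y j)

  β-⊕ʳ : (x y y′ : V m) → β x (y ⊕ y′) ≡ β x y xor β x y′
  β-⊕ʳ x y y′ = trans (xorSum-cong λ i → trans (xorSum-cong (term i)) (xorSum-xor {k = m} _ _))
                      (xorSum-xor {k = m} _ _)
    where
    distrib : ∀ a b c d → a ∧ (b ∧ (c xor d)) ≡ (a ∧ (b ∧ c)) xor (a ∧ (b ∧ d))
    distrib a b c d = trans (cong (a ∧_) (∧-distribˡ-xor b c d)) (∧-distribˡ-xor a (b ∧ c) (b ∧ d))
    term : ∀ i j → A i j ∧ (lookup x i ∧ lookup (y ⊕ y′) j)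
                 ≡ (A i j ∧ (lookup x i ∧ lookup y j)) xor (A i j ∧ (lookup x i ∧ lookup y′ j))
    term i j rewrite lookup-⊕ y y′ j = distrib (A i j) (lookup x i) (lookup y j) (lookup y′ j)

  B≡β : (x y : V m) → B x y ≡ β x y xor β y x
  B≡β x y = begin
    Q (x ⊕ y) xor (β x x xor β y y)
      ≡⟨ cong (_xor (β x x xor β y y))
              (trans (β-⊕ˡ x y (x ⊕ y)) (cong₂ _xor_ (β-⊕ʳ x x y) (β-⊕ʳ y x y))) ⟩
    ((β x x xor β x y) xor (β y x xor β y y)) xor (β x x xor β y y)
      ≡⟨ cancel (β x x) (β x y) (β y x) (β y y) ⟩
    β x y xor β y x ∎
    where
    open ≡-Reasoning
    cancel : ∀ a b c d → ((a xor b) xor (c xor d)) xor (a xor d) ≡ b xor c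
    cancel a b c d = trans (cong (λ t → (t xor (c xor d)) xor (a xor d)) (xor-comm a b))
                           (trans (cong (_xor (a xor d)) (xor-interchange b a c d)) (xor-cancelʳ (b xor c) (a xor d)))

  B-sym : (x y : V m) → B x y ≡ B y x
  B-sym x y = cong₂ _xor_ (cong Q (⊕-comm x y)) (xor-comm (Q x) (Q y))

  B-self : (x : V m) → B x x ≡ false
  B-self x = trans (B≡β x x) (xor-same (β x x))

  ≢-by-B : {x y w : V m} → B x w ≡ true → B y w ≡ false → x ≢ y
  ≢-by-B x·w y·w refl = true≢false (trans (sym x·w) y·w)

  B≡true⇒≢ : {x y : V m} → B x y ≡ true → x ≢ y
  B≡true⇒≢ {y = y} x·y = ≢-by-B x·y (B-self y)

  B-⊕ˡ : (x x′ y : V m) → B (x ⊕ x′) y ≡ B x y xor B x′ y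
  B-⊕ˡ x x′ y = begin
    B (x ⊕ x′) y                              ≡⟨ B≡β (x ⊕ x′) y ⟩
    β (x ⊕ x′) y xor β y (x ⊕ x′)             ≡⟨ cong₂ _xor_ (β-⊕ˡ x x′ y) (β-⊕ʳ y x x′) ⟩
    (β x y xor β x′ y) xor (β y x xor β y x′) ≡⟨ xor-interchange (β x y) _ _ _ ⟩
    (β x y xor β y x) xor (β x′ y xor β y x′) ≡⟨ sym (cong₂ _xor_ (B≡β x y) (B≡β x′ y)) ⟩
    B x y xor B x′ y                          ∎
    where open ≡-Reasoning

  B-⊕ʳ : (x y y′ : V m) → B x (y ⊕ y′) ≡ B x y xor B x y′
  B-⊕ʳ x y y′ = trans (B-sym x (y ⊕ y′)) (trans (B-⊕ˡ y y′ x) (cong₂ _xor_ (B-sym y x) (B-sym y′ x)))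

  Q-⊕ : (x y : V m) → Q (x ⊕ y) ≡ B x y xor (Q x xor Q y)
  Q-⊕ x y = sym (xor-cancelʳ (Q (x ⊕ y)) (Q x xor Q y))

  B-zeroˡ : (y : V m) → B zeroV y ≡ false
  B-zeroˡ y = double-zero (B zeroV y) (trans (cong (λ z → B z y) (sym (⊕-self zeroV))) (B-⊕ˡ zeroV zeroV y))
    where
    double-zero : ∀ b → b ≡ b xor b → b ≡ false
    double-zero b eq = trans eq (xor-same b)

  Q-zeroV : Q zeroV ≡ false
  Q-zeroV = trans (cong Q (sym (⊕-self zeroV))) (trans (Q-⊕ zeroV zeroV)
                  (cong₂ _xor_ (B-self zeroV) (xor-same (Q zeroV))))

  B-scaleˡ : (b : Bool) (x y : V m) → B (scale b x) y ≡ b ∧ B x y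
  B-scaleˡ true  x y = cong (λ z → B z y) (scale-true x)
  B-scaleˡ false x y = trans (cong (λ z → B z y) (scale-false x)) (B-zeroˡ y)

  Q-scale : (b : Bool) (x : V m) → Q (scale b x) ≡ b ∧ Q x
  Q-scale true  x = cong Q (scale-true x)
  Q-scale false x = trans (cong Q (scale-false x)) Q-zeroV

  B-lcˡ : (e : Fin k → V m) (c : Fin k → Bool) (y : V m) → B (lc e c) y ≡ xorSum (λ i → c i ∧ B (e i) y)
  B-lcˡ {zero}  e c y = B-zeroˡ y
  B-lcˡ {suc k} e c y = trans (B-⊕ˡ (scale (c zero) (e zero)) (lc (e ∘ suc) (c ∘ suc)) y)
                              (cong₂ _xor_ (B-scaleˡ (c zero) (e zero) y) (B-lcˡ (e ∘ suc) (c ∘ suc) y))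

  B-lcʳ : (e : Fin k → V m) (c : Fin k → Bool) (x : V m) → B x (lc e c) ≡ xorSum (λ i → c i ∧ B x (e i))
  B-lcʳ e c x = trans (B-sym x (lc e c)) (trans (B-lcˡ e c x) (xorSum-cong λ i → cong (c i ∧_) (B-sym (e i) x)))

  TotallySingular : (Fin k → V m) → Set
  TotallySingular e = (∀ i → Q (e i) ≡ false) × (∀ i j → B (e i) (e j) ≡ false)

  B-lcˡ-false : (e : Fin k → V m) (y : V m) → (∀ i → B (e i) y ≡ false) → ∀ c → B (lc e c) y ≡ false
  B-lcˡ-false e y e⊥y c =
    trans (B-lcˡ e c y) (xorSum-false λ i → trans (cong (c i ∧_) (e⊥y i)) (∧-zeroʳ (c i)))

  B-lcʳ-false : (e : Fin k → V m) (x : V m) → (∀ i → B x (e i) ≡ false) → ∀ c → B x (lc e c) ≡ false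
  B-lcʳ-false e x x⊥e c = trans (B-sym x (lc e c)) (B-lcˡ-false e x (λ i → trans (B-sym (e i) x) (x⊥e i)) c)

  B-lc-orthogonal : (e : Fin k → V m) (e′ : Fin l → V m) → (∀ i j → B (e i) (e′ j) ≡ false) →
                    ∀ c c′ → B (lc e c) (lc e′ c′) ≡ false
  B-lc-orthogonal e e′ e⊥e′ c = B-lcʳ-false e′ (lc e c) (λ j → B-lcˡ-false e (e′ j) (λ i → e⊥e′ i j) c)

  Q-lc-singular : {e : Fin k → V m} → TotallySingular e → ∀ c → Q (lc e c) ≡ false
  Q-lc-singular {zero}      _                c = Q-zeroV
  Q-lc-singular {suc k} {e} (Q-e≡0 , B-e≡0) c =
    trans (Q-⊕ (scale (c zero) (e zero)) (lc (e ∘ suc) (c ∘ suc)))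
          (cong₂ _xor_ (trans (B-scaleˡ (c zero) (e zero) _)
                              (vanish (B-lcʳ-false (e ∘ suc) (e zero) (B-e≡0 zero ∘ suc) (c ∘ suc))))
                       (cong₂ _xor_ (trans (Q-scale (c zero) (e zero)) (vanish (Q-e≡0 zero)))
                                    (Q-lc-singular ((Q-e≡0 ∘ suc) , (λ i j → B-e≡0 (suc i) (suc j))) (c ∘ suc))))
    where
    vanish : ∀ {b} → b ≡ false → c zero ∧ b ≡ false
    vanish refl = ∧-zeroʳ (c zero)

  B-scaleʳ : (b : Bool) (x y : V m) → B x (scale b y) ≡ b ∧ B x y
  B-scaleʳ b x y = trans (B-sym x (scale b y)) (trans (B-scaleˡ b y x) (cong (b ∧_) (B-sym y x)))

  B-⊕-scale-⊥ : (x y w : V m) (b : Bool) → B x w ≡ false → B x (y ⊕ scale b w) ≡ B x y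
  B-⊕-scale-⊥ x y w b x⊥w = begin
    B x (y ⊕ scale b w)       ≡⟨ B-⊕ʳ x y (scale b w) ⟩
    B x y xor B x (scale b w) ≡⟨ cong (B x y xor_)
                                      (trans (B-scaleʳ b x w) (trans (cong (b ∧_) x⊥w) (∧-zeroʳ b))) ⟩
    B x y xor false           ≡⟨ xor-identityʳ (B x y) ⟩
    B x y                     ∎
    where open ≡-Reasoning

  B-⊕-scale-cancel : (x y w : V m) → B x w ≡ true → B x (y ⊕ scale (B y x) w) ≡ false
  B-⊕-scale-cancel x y w x·w = begin
    B x (y ⊕ scale (B y x) w)            ≡⟨ B-⊕ʳ x y (scale (B y x) w) ⟩
    B x y xor B x (scale (B y x) w)      ≡⟨ cong (B x y xor_)
                                                 (trans (B-scaleʳ (B y x) x w) (cong (B y x ∧_) x·w)) ⟩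
    B x y xor (B y x ∧ true)             ≡⟨ cong (B x y xor_) (trans (∧-identityʳ (B y x)) (B-sym y x)) ⟩
    B x y xor B x y                      ≡⟨ xor-same (B x y) ⟩
    false                                ∎
    where open ≡-Reasoning

  IsDual : (Fin k → V m) → (Fin k → V m) → Set
  IsDual e d = ∀ i j → B (e i) (d j) ≡ δ i j

  B-lc-dual : (e d : Fin k → V m) → IsDual e d → ∀ i c → B (e i) (lc d c) ≡ c i
  B-lc-dual e d e∙d i c =
    trans (B-lcʳ d c (e i)) (trans (xorSum-cong λ j → cong (c j ∧_) (e∙d i j)) (xorSum-δ c i))

  head-dual : NonDegenerate A → {e : Fin (suc k) → V m} → Independent e →
              (x : Fin k → V m) → IsDual (e ∘ suc) x →
              Σ (V m) λ x₀ → B (e zero) x₀ ≡ true × (∀ i → B (e (suc i)) x₀ ≡ false)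
  head-dual {k} nd {e} ind x e∙x = x₀ , head·x₀ , tail⊥x₀
    where
    -- lc e c′ is e zero made orthogonal to every x j; independence makes it nonzero.
    c′ : Fin (suc k) → Bool
    c′ zero    = true
    c′ (suc j) = B (e zero) (x j)
    y : V m
    y = proj₁ (nd (lc e c′) (independent-lc {e = e} ind c′ refl))
    e′·y : B (lc e c′) y ≡ true
    e′·y = proj₂ (nd (lc e c′) (independent-lc {e = e} ind c′ refl))
    x₀ : V m
    x₀ = y ⊕ lc x (λ j → B y (e (suc j)))
    tail⊥x₀ : ∀ i → B (e (suc i)) x₀ ≡ false
    tail⊥x₀ i = begin
      B (e (suc i)) x₀                             ≡⟨ B-⊕ʳ (e (suc i)) y _ ⟩
      B (e (suc i)) y xor B (e (suc i)) (lc x _)   ≡⟨ cong (B (e (suc i)) y xor_) (B-lc-dual (e ∘ suc) x e∙x i _) ⟩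
      B (e (suc i)) y xor B y (e (suc i))          ≡⟨ cong (_xor B y (e (suc i))) (B-sym (e (suc i)) y) ⟩
      B y (e (suc i)) xor B y (e (suc i))          ≡⟨ xor-same (B y (e (suc i))) ⟩
      false                                        ∎
      where open ≡-Reasoning
    head·x₀ : B (e zero) x₀ ≡ true
    head·x₀ = begin
      B (e zero) x₀
        ≡⟨ B-⊕ʳ (e zero) y _ ⟩
      B (e zero) y xor B (e zero) (lc x _)
        ≡⟨ cong (B (e zero) y xor_) (B-lcʳ x _ (e zero)) ⟩
      B (e zero) y xor xorSum (λ j → B y (e (suc j)) ∧ B (e zero) (x j))
        ≡⟨ cong (B (e zero) y xor_) (xorSum-cong λ j →
             trans (∧-comm (B y (e (suc j))) _) (cong (B (e zero) (x j) ∧_) (B-sym y (e (suc j))))) ⟩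
      B (e zero) y xor xorSum (λ j → c′ (suc j) ∧ B (e (suc j)) y)
        ≡⟨ sym (B-lcˡ e c′ y) ⟩
      B (lc e c′) y
        ≡⟨ e′·y ⟩
      true ∎
      where open ≡-Reasoning

  dual : NonDegenerate A → {e : Fin k → V m} → Independent e → Σ (Fin k → V m) (IsDual e)
  dual {zero}  nd ind = (λ ()) , (λ ())
  dual {suc k} nd {e} ind = d , e∙d
    where
    x : Fin k → V m
    x = proj₁ (dual nd (independent-tail {e = e} ind))
    e∙x : IsDual (e ∘ suc) x
    e∙x = proj₂ (dual nd (independent-tail {e = e} ind))
    x₀ : V m
    x₀ = proj₁ (head-dual nd {e = e} ind x e∙x)
    head·x₀ : B (e zero) x₀ ≡ true
    head·x₀ = proj₁ (proj₂ (head-dual nd {e = e} ind x e∙x))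
    tail⊥x₀ : ∀ i → B (e (suc i)) x₀ ≡ false
    tail⊥x₀ = proj₂ (proj₂ (head-dual nd {e = e} ind x e∙x))
    d : Fin (suc k) → V m
    d zero    = x₀
    d (suc j) = x j ⊕ scale (B (x j) (e zero)) x₀
    e∙d : IsDual e d
    e∙d zero    zero    = head·x₀
    e∙d zero    (suc j) = B-⊕-scale-cancel (e zero) (x j) x₀ head·x₀
    e∙d (suc i) zero    = tail⊥x₀ i
    e∙d (suc i) (suc j) = trans (B-⊕-scale-⊥ (e (suc i)) (x j) x₀ _ (tail⊥x₀ i)) (e∙x i j)

  Q-⊕-scale-Q : (d w : V m) → Q w ≡ false → B d w ≡ true → Q (d ⊕ scale (Q d) w) ≡ false
  Q-⊕-scale-Q d w Q-w d·w = begin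
    Q (d ⊕ scale q w)
      ≡⟨ Q-⊕ d (scale q w) ⟩
    B d (scale q w) xor (Q d xor Q (scale q w))
      ≡⟨ cong₂ _xor_ (trans (B-scaleʳ q d w) (cong (q ∧_) d·w))
                     (cong (q xor_) (trans (Q-scale q w) (cong (q ∧_) Q-w))) ⟩
    (q ∧ true) xor (q xor (q ∧ false))
      ≡⟨ vanish q ⟩
    false ∎
    where
    open ≡-Reasoning
    q = Q d
    vanish : ∀ a → (a ∧ true) xor (a xor (a ∧ false)) ≡ false
    vanish true  = refl
    vanish false = refl

  record HyperbolicPartners (g d : Fin k → V m) : Set where
    field
      f          : Fin k → V m
      f-singular : TotallySingular f
      g∙f        : IsDual g f
      agrees     : ∀ w → (∀ i → B w (g i) ≡ false) → ∀ j → B w (f j) ≡ B w (d j)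

  -- agrees keeps the partners of g ∘ suc orthogonal to g zero and f zero, both of which are orthogonal to g ∘ suc.
  hyperbolic-partners : (g d : Fin k → V m) → TotallySingular g → IsDual g d → HyperbolicPartners g d
  hyperbolic-partners {zero}  g d _ _ =
    record { f = λ () ; f-singular = (λ ()) , (λ ()) ; g∙f = λ () ; agrees = λ _ _ () }
  hyperbolic-partners {suc k} g d (Q-g , B-g) g∙d = record
    { f = f ; f-singular = Q-f , B-f ; g∙f = g∙f ; agrees = agrees }
    where
    f₀ : V m
    f₀ = d zero ⊕ scale (Q (d zero)) (g zero)
    d′ : Fin k → V m
    d′ j = d (suc j) ⊕ scale (B (d (suc j)) f₀) (g zero)
    g∙d′ : IsDual (g ∘ suc) d′
    g∙d′ i j = trans (B-⊕-scale-⊥ (g (suc i)) (d (suc j)) (g zero) _ (B-g (suc i) zero)) (g∙d (suc i) (suc j))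
    open HyperbolicPartners
           (hyperbolic-partners (g ∘ suc) d′ ((Q-g ∘ suc) , (λ i j → B-g (suc i) (suc j))) g∙d′)
      renaming (f to f′; f-singular to f′-singular; g∙f to g∙f′; agrees to agrees′)
    g∙f₀ : ∀ i → B (g i) f₀ ≡ δ i zero
    g∙f₀ i = trans (B-⊕-scale-⊥ (g i) (d zero) (g zero) _ (B-g i zero)) (g∙d i zero)
    g₀⊥f′ : ∀ j → B (g zero) (f′ j) ≡ false
    g₀⊥f′ j = trans (agrees′ (g zero) (B-g zero ∘ suc) j)
                    (trans (B-⊕-scale-⊥ (g zero) (d (suc j)) (g zero) _ (B-g zero zero)) (g∙d zero (suc j)))
    f₀⊥f′ : ∀ j → B f₀ (f′ j) ≡ false
    f₀⊥f′ j = trans (agrees′ f₀ (λ i → trans (B-sym f₀ (g (suc i))) (g∙f₀ (suc i))) j)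
                    (B-⊕-scale-cancel f₀ (d (suc j)) (g zero) (trans (B-sym f₀ (g zero)) (g∙f₀ zero)))
    f : Fin (suc k) → V m
    f zero    = f₀
    f (suc j) = f′ j
    Q-f : ∀ j → Q (f j) ≡ false
    Q-f zero    = Q-⊕-scale-Q (d zero) (g zero) (Q-g zero) (trans (B-sym (d zero) (g zero)) (g∙d zero zero))
    Q-f (suc j) = proj₁ f′-singular j
    B-f : ∀ i j → B (f i) (f j) ≡ false
    B-f zero    zero    = B-self f₀
    B-f zero    (suc j) = f₀⊥f′ j
    B-f (suc i) zero    = trans (B-sym (f′ i) f₀) (f₀⊥f′ i)
    B-f (suc i) (suc j) = proj₂ f′-singular i j
    g∙f : IsDual g f
    g∙f i       zero    = g∙f₀ i
    g∙f zero    (suc j) = g₀⊥f′ j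
    g∙f (suc i) (suc j) = g∙f′ i j
    agrees : ∀ w → (∀ i → B w (g i) ≡ false) → ∀ j → B w (f j) ≡ B w (d j)
    agrees w w⊥g zero    = B-⊕-scale-⊥ w (d zero) (g zero) _ (w⊥g zero)
    agrees w w⊥g (suc j) = trans (agrees′ w (w⊥g ∘ suc) j) (B-⊕-scale-⊥ w (d (suc j)) (g zero) _ (w⊥g zero))

  record HyperbolicFrame (k : ℕ) : Set where
    field
      g f        : Fin k → V m
      g-singular : TotallySingular g
      f-singular : TotallySingular f
      g∙f        : IsDual g f

  restrict : HyperbolicFrame (k + l) → HyperbolicFrame k
  restrict {l = l} F = record
    { g          = g ∘ (_↑ˡ l)
    ; f          = f ∘ (_↑ˡ l)
    ; g-singular = (proj₁ g-singular ∘ (_↑ˡ l)) , (λ i j → proj₂ g-singular (i ↑ˡ l) (j ↑ˡ l))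
    ; f-singular = (proj₁ f-singular ∘ (_↑ˡ l)) , (λ i j → proj₂ f-singular (i ↑ˡ l) (j ↑ˡ l))
    ; g∙f        = λ i j → trans (g∙f (i ↑ˡ l) (j ↑ˡ l)) (δ-↑ˡ i j)
    }
    where open HyperbolicFrame F

  module Coordinates (F : HyperbolicFrame k) where
    open HyperbolicFrame F

    Coord : Set
    Coord = V k × V k

    point : Coord → V m
    point (x , y) = comb g x ⊕ comb f y

    ⟪_,_⟫ : Coord → Coord → Bool
    ⟪ x , y ⟫ = (proj₁ x · proj₂ y) xor (proj₁ y · proj₂ x)

    _⊞_ : Coord → Coord → Coord
    (x , y) ⊞ (x′ , y′) = (x ⊕ x′) , (y ⊕ y′)

    B-comb-g-f : (x y : V k) → B (comb g x) (comb f y) ≡ x · y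
    B-comb-g-f x y = trans (B-lcˡ g (lookup x) (comb f y))
                           (xorSum-cong λ i → cong (lookup x i ∧_) (B-lc-dual g f g∙f i (lookup y)))

    B-point : (a b : Coord) → B (point a) (point b) ≡ ⟪ a , b ⟫
    B-point (x , y) (x′ , y′) = begin
      B (comb g x ⊕ comb f y) (comb g x′ ⊕ comb f y′)
        ≡⟨ B-⊕ˡ (comb g x) (comb f y) _ ⟩
      B (comb g x) (comb g x′ ⊕ comb f y′) xor B (comb f y) (comb g x′ ⊕ comb f y′)
        ≡⟨ cong₂ _xor_ (B-⊕ʳ (comb g x) (comb g x′) (comb f y′))
                       (B-⊕ʳ (comb f y) (comb g x′) (comb f y′)) ⟩
      (B (comb g x) (comb g x′) xor B (comb g x) (comb f y′))
        xor (B (comb f y) (comb g x′) xor B (comb f y) (comb f y′))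
        ≡⟨ cong₂ _xor_ (cong₂ _xor_ (B-lc-orthogonal g g (proj₂ g-singular) (lookup x) (lookup x′))
                                    (B-comb-g-f x y′))
                       (cong₂ _xor_ (trans (B-sym (comb f y) (comb g x′)) (B-comb-g-f x′ y))
                                    (B-lc-orthogonal f f (proj₂ f-singular) (lookup y) (lookup y′))) ⟩
      (x · y′) xor ((x′ · y) xor false)
        ≡⟨ cong ((x · y′) xor_) (xor-identityʳ (x′ · y)) ⟩
      (x · y′) xor (x′ · y) ∎
      where open ≡-Reasoning

    Q-point : (a : Coord) → Q (point a) ≡ proj₁ a · proj₂ a
    Q-point (x , y) = begin
      Q (comb g x ⊕ comb f y)
        ≡⟨ Q-⊕ (comb g x) (comb f y) ⟩
      B (comb g x) (comb f y) xor (Q (comb g x) xor Q (comb f y))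
        ≡⟨ cong₂ _xor_ (B-comb-g-f x y)
                       (cong₂ _xor_ (Q-lc-singular g-singular (lookup x)) (Q-lc-singular f-singular (lookup y))) ⟩
      (x · y) xor false
        ≡⟨ xor-identityʳ (x · y) ⟩
      x · y ∎
      where open ≡-Reasoning

    point-⊕ : (a b : Coord) → point a ⊕ point b ≡ point (a ⊞ b)
    point-⊕ (x , y) (x′ , y′) = trans (⊕-interchange (comb g x) (comb f y) (comb g x′) (comb f y′))
                                      (cong₂ _⊕_ (comb-⊕ g x x′) (comb-⊕ f y y′))

    B-point-g : (a : Coord) (i : Fin k) → B (point a) (g i) ≡ lookup (proj₂ a) i
    B-point-g (x , y) i = begin
      B (comb g x ⊕ comb f y) (g i)
        ≡⟨ B-⊕ˡ (comb g x) (comb f y) (g i) ⟩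
      B (comb g x) (g i) xor B (comb f y) (g i)
        ≡⟨ cong₂ _xor_ (B-lcˡ-false g (g i) (λ j → proj₂ g-singular j i) (lookup x))
                       (trans (B-sym (comb f y) (g i)) (B-lc-dual g f g∙f i (lookup y))) ⟩
      lookup y i ∎
      where open ≡-Reasoning

    B-point-f : (a : Coord) (i : Fin k) → B (point a) (f i) ≡ lookup (proj₁ a) i
    B-point-f (x , y) i = begin
      B (comb g x ⊕ comb f y) (f i)
        ≡⟨ B-⊕ˡ (comb g x) (comb f y) (f i) ⟩
      B (comb g x) (f i) xor B (comb f y) (f i)
        ≡⟨ cong₂ _xor_ B-comb-g (B-lcˡ-false f (f i) (λ j → proj₂ f-singular j i) (lookup y)) ⟩
      lookup x i xor false
        ≡⟨ xor-identityʳ (lookup x i) ⟩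
      lookup x i ∎
      where
      open ≡-Reasoning
      B-comb-g : B (comb g x) (f i) ≡ lookup x i
      B-comb-g = trans (B-lcˡ g (lookup x) (f i))
                       (trans (xorSum-cong λ j → cong (lookup x j ∧_) (trans (g∙f j i) (δ-sym j i)))
                              (xorSum-δ (lookup x) i))

    point-injective : (a b : Coord) → point a ≡ point b → a ≡ b
    point-injective a b eq = cong₂ _,_
      (lookup-ext λ i → trans (sym (B-point-f a i)) (trans (cong (λ z → B z (f i)) eq) (B-point-f b i)))
      (lookup-ext λ i → trans (sym (B-point-g a i)) (trans (cong (λ z → B z (g i)) eq) (B-point-g b i)))

module Subspace {n} {A : QForm m} (Π : Generator n A) where
  open QuadraticForm A
  open Generator Π

  _∈Π : V m → Set
  x ∈Π = π x ≡ true

  lc-basis-∈Π : ∀ c → lc basis c ∈Π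
  lc-basis-∈Π c = subst _∈Π (lc-cong basis (lookup∘tabulate c)) (proj₂ (span _) (tabulate c , refl))

  ∈Π-⊕ : {x y : V m} → x ∈Π → y ∈Π → (x ⊕ y) ∈Π
  ∈Π-⊕ {x} {y} x∈Π y∈Π with proj₁ (span x) x∈Π | proj₁ (span y) y∈Π
  ... | c , refl | c′ , refl = subst _∈Π (sym (comb-⊕ basis c c′)) (lc-basis-∈Π (lookup (c ⊕ c′)))

  Q-∈Π : {x : V m} → x ∈Π → Q x ≡ false
  Q-∈Π {x} x∈Π with proj₁ (span x) x∈Π
  ... | c , refl = inQ c

  B-∈Π : {x y : V m} → x ∈Π → y ∈Π → B x y ≡ false
  B-∈Π {x} {y} x∈Π y∈Π = begin
    B x y                       ≡⟨ sym (xor-identityʳ (B x y)) ⟩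
    B x y xor (false xor false) ≡⟨ cong (B x y xor_) (cong₂ _xor_ (sym (Q-∈Π x∈Π)) (sym (Q-∈Π y∈Π))) ⟩
    B x y xor (Q x xor Q y)     ≡⟨ sym (Q-⊕ x y) ⟩
    Q (x ⊕ y)                   ≡⟨ Q-∈Π (∈Π-⊕ x∈Π y∈Π) ⟩
    false                       ∎
    where open ≡-Reasoning

  basis-∈Π : ∀ i → basis i ∈Π
  basis-∈Π i = subst _∈Π (lc-δ basis i) (lc-basis-∈Π (δ i))

  zeroV-∈Π : zeroV ∈Π
  zeroV-∈Π = subst _∈Π (lc-false basis (λ _ → refl)) (lc-basis-∈Π (λ _ → false))

  ∉Π⇒nz : {x : V m} → π x ≡ false → nz x ≡ true
  ∉Π⇒nz {x} x∉Π = ¬-not λ nz-x →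
    true≢false (trans (sym (subst _∈Π (sym (nz≡false⇒≡zeroV x nz-x)) zeroV-∈Π)) x∉Π)

  ∉Π-by-B : {x y : V m} → y ∈Π → B x y ≡ true → π x ≡ false
  ∉Π-by-B y∈Π x·y = ¬-not λ x∈Π → true≢false (trans (sym x·y) (B-∈Π x∈Π y∈Π))

  scale-∈Π : (b : Bool) {x : V m} → x ∈Π → scale b x ∈Π
  scale-∈Π true  {x} x∈Π = subst _∈Π (sym (scale-true x)) x∈Π
  scale-∈Π false {x} _   = subst _∈Π (sym (scale-false x)) zeroV-∈Π

  lc-∈Π : (e : Fin k → V m) → (∀ i → e i ∈Π) → ∀ c → lc e c ∈Π
  lc-∈Π {zero}  e e∈Π c = zeroV-∈Π
  lc-∈Π {suc k} e e∈Π c =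
    ∈Π-⊕ (scale-∈Π (c zero) (e∈Π zero)) (lc-∈Π (e ∘ suc) (e∈Π ∘ suc) (c ∘ suc))

  basis-singular : TotallySingular basis
  basis-singular = (λ i → Q-∈Π (basis-∈Π i)) , (λ i j → B-∈Π (basis-∈Π i) (basis-∈Π j))

  basis-frame : NonDegenerate A → HyperbolicFrame (suc n)
  basis-frame nd = record
    { g          = basis
    ; f          = f
    ; g-singular = basis-singular
    ; f-singular = f-singular
    ; g∙f        = g∙f
    }
    where
    d = dual nd {e = basis} indep
    open HyperbolicPartners (hyperbolic-partners basis (proj₁ d) basis-singular (proj₂ d))

record Completion {Vtx : Set} (E : Vtx → Vtx → Set) (u v : Vtx) : Set where
  field
    z          : Vtx
    z≢u        : z ≢ u
    z≢v        : z ≢ v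
    z≁u        : ¬ E z u
    z≁v        : ¬ E z v
    dominates  : ∀ w → E w u → E w v → E w z

NonEdgesCompletable : {Vtx : Set} → (Vtx → Vtx → Set) → Set
NonEdgesCompletable E = ∀ u v → u ≢ v → ¬ E u v → Completion E u v

completable-transport : {V₁ V₂ : Set} {E₁ : V₁ → V₁ → Set} {E₂ : V₂ → V₂ → Set} →
  Isomorphic E₁ E₂ → NonEdgesCompletable E₂ → NonEdgesCompletable E₁
completable-transport {V₁ = V₁} {E₁ = E₁} {E₂} (φ , φ-adj) complete u v u≢v u≁v = record
  { z         = z
  ; z≢u       = λ eq → z′≢u (trans (sym to-z) (cong to eq))
  ; z≢v       = λ eq → z′≢v (trans (sym to-z) (cong to eq))
  ; z≁u       = λ zu → z′≁u (subst (λ t → E₂ t (to u)) to-z (proj₁ (φ-adj z u) zu))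
  ; z≁v       = λ zv → z′≁v (subst (λ t → E₂ t (to v)) to-z (proj₁ (φ-adj z v) zv))
  ; dominates = λ w wu wv → proj₂ (φ-adj w z)
                  (subst (E₂ (to w)) (sym to-z)
                         (dominates′ (to w) (proj₁ (φ-adj w u) wu) (proj₁ (φ-adj w v) wv)))
  }
  where
  open Bijection φ using (to; injective; strictlySurjective)
  open Completion (complete (to u) (to v) (u≢v ∘ injective) (u≁v ∘ proj₂ (φ-adj u v)))
    renaming (z to z′; z≢u to z′≢u; z≢v to z′≢v; z≁u to z′≁u; z≁v to z′≁v; dominates to dominates′)
  z : V₁
  z = proj₁ (strictlySurjective z′)
  to-z : to z ≡ z′
  to-z = proj₂ (strictlySurjective z′)

vertex-≡ : {P : V m → Bool} {a b : Σ (V m) (λ x → P x ≡ true)} → proj₁ a ≡ proj₁ b → a ≡ b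
vertex-≡ {a = x , p} {b = .x , q} refl = cong (x ,_) (≡-irrelevant p q)
  where open Decidable⇒UIP _≟_ using (≡-irrelevant)

𝟙 : Bool → ℕ
𝟙 b = if b then 1 else 0

countB-∷ : (p : V m → Bool) (x : V m) (xs : List (V m)) → countB p (x ∷ xs) ≡ 𝟙 (p x) + countB p xs
countB-∷ p x xs with p x
... | true  = refl
... | false = refl

countB-line : (p : V m → Bool) (x y : V m) → countB p (line x y) ≡ 𝟙 (p x) + (𝟙 (p y) + 𝟙 (p (x ⊕ y)))
countB-line p x y =
  trans (countB-∷ p x _) (cong (𝟙 (p x) +_) (trans (countB-∷ p y _) (cong (𝟙 (p y) +_)
        (trans (countB-∷ p (x ⊕ y) []) (+-identityʳ _)))))

module Lines (A : QForm m) where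
  open QuadraticForm A

  onQ-⊕ : {x y : V m} → x ≢ y → onQ A (x ⊕ y) ≡ not (B x y xor (Q x xor Q y))
  onQ-⊕ {x} {y} x≢y = cong₂ _∧_ (≢⇒nz-⊕ x≢y) (cong not (Q-⊕ x y))

  lineMeetsQ-≡ : {x y : V m} {a b : Bool} → x ≢ y → onQ A x ≡ a → onQ A y ≡ b → Q x ≡ Q y →
                 lineMeetsQ A x y ≡ 𝟙 a + (𝟙 b + 𝟙 (not (B x y)))
  lineMeetsQ-≡ {x} {y} x≢y x-on y-on Qx≡Qy =
    trans (countB-line (onQ A) x y) (cong₂ _+_ (cong 𝟙 x-on) (cong₂ _+_ (cong 𝟙 y-on) (cong 𝟙 third)))
    where
    third : onQ A (x ⊕ y) ≡ not (B x y)
    third = trans (onQ-⊕ x≢y) (cong not (trans (cong (B x y xor_) (trans (cong (_xor Q y) Qx≡Qy) (xor-same (Q y))))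
                                               (xor-identityʳ (B x y))))

module NOGraph (A : QForm m) where
  open QuadraticForm A
  open Lines A

  NOVert-data : ((x , _) : NOVert A) → nz x ≡ true × Q x ≡ true × onQ A x ≡ false
  NOVert-data (x , h) with nz x | Q x
  ... | true | true = refl , refl , refl

  NOVert-intro : {x : V m} → nz x ≡ true → Q x ≡ true → (nz x ∧ not (onQ A x)) ≡ true
  NOVert-intro nz-x Q-x = cong₂ _∧_ nz-x (cong not (cong₂ _∧_ nz-x (cong not Q-x)))

  tangent⇔orthogonal : ((x , _) (y , _) : NOVert A) → x ≢ y → Tangent A x y ⇔ (B x y ≡ false)
  tangent⇔orthogonal (x , px) (y , py) x≢y =
    mk⇔ (λ t → 𝟙-not-1 (trans (sym meets) t)) (λ x⊥y → trans meets (cong (𝟙 ∘ not) x⊥y))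
    where
    x-data = NOVert-data (x , px)
    y-data = NOVert-data (y , py)
    meets : lineMeetsQ A x y ≡ 𝟙 (not (B x y))
    meets = lineMeetsQ-≡ x≢y (proj₂ (proj₂ x-data)) (proj₂ (proj₂ y-data))
                         (trans (proj₁ (proj₂ x-data)) (sym (proj₁ (proj₂ y-data))))
    𝟙-not-1 : {b : Bool} → 𝟙 (not b) ≡ 1 → b ≡ false
    𝟙-not-1 {false} _ = refl

  NO-completable : NonEdgesCompletable (NOAdj A)
  NO-completable X@(x , px) Y@(y , py) X≢Y X≁Y = record
    { z         = Z
    ; z≢u       = B≡true⇒≢ z·x ∘ cong proj₁
    ; z≢v       = B≡true⇒≢ z·y ∘ cong proj₁
    ; z≁u       = Z-not-tangent X z·x
    ; z≁v       = Z-not-tangent Y z·y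
    ; dominates = dominates
    }
    where
    x≢y : x ≢ y
    x≢y = X≢Y ∘ vertex-≡
    x·y : B x y ≡ true
    x·y = ¬-not λ x⊥y → X≁Y (x≢y , Equivalence.from (tangent⇔orthogonal X Y x≢y) x⊥y)
    Q-z : Q (x ⊕ y) ≡ true
    Q-z = trans (Q-⊕ x y)
                (cong₂ _xor_ x·y (cong₂ _xor_ (proj₁ (proj₂ (NOVert-data X))) (proj₁ (proj₂ (NOVert-data Y)))))
    Z : NOVert A
    Z = x ⊕ y , NOVert-intro {x ⊕ y} (≢⇒nz-⊕ x≢y) Q-z
    z·x : B (x ⊕ y) x ≡ true
    z·x = trans (B-⊕ˡ x y x) (trans (cong (_xor B y x) (B-self x)) (trans (B-sym y x) x·y))
    z·y : B (x ⊕ y) y ≡ true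
    z·y = trans (B-⊕ˡ x y y) (trans (cong (B x y xor_) (B-self y)) (trans (xor-identityʳ (B x y)) x·y))
    Z-not-tangent : (W : NOVert A) → B (x ⊕ y) (proj₁ W) ≡ true → ¬ NOAdj A Z W
    Z-not-tangent W z·w (z≢w , t) = true≢false (trans (sym z·w) (Equivalence.to (tangent⇔orthogonal Z W z≢w) t))
    dominates : ∀ W → NOAdj A W X → NOAdj A W Y → NOAdj A W Z
    dominates W@(w , _) (w≢x , t-wx) (w≢y , t-wy) = w≢z , Equivalence.from (tangent⇔orthogonal W Z w≢z) w⊥z
      where
      w⊥x : B w x ≡ false
      w⊥x = Equivalence.to (tangent⇔orthogonal W X w≢x) t-wx
      w⊥z : B w (x ⊕ y) ≡ false
      w⊥z = trans (B-⊕ʳ w x y) (cong₂ _xor_ w⊥x (Equivalence.to (tangent⇔orthogonal W Y w≢y) t-wy))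
      w≢z : w ≢ x ⊕ y
      w≢z = ≢-by-B z·x w⊥x ∘ sym

module GGraph {n} {A : QForm m} (Π : Generator n A) where
  open QuadraticForm A
  open Lines A
  open Subspace Π
  open Generator Π

  GVert-data : ((x , _) : GVert A Π) → onQ A x ≡ true × Q x ≡ false × π x ≡ false
  GVert-data (x , h) with nz x | Q x | π x
  ... | true | false | false = refl , refl , refl

  GVert-intro : {x : V m} → Q x ≡ false → π x ≡ false → (onQ A x ∧ not (π x)) ≡ true
  GVert-intro {x} Q-x x∉Π = cong₂ _∧_ (cong₂ _∧_ (∉Π⇒nz x∉Π) (cong not Q-x)) (cong not x∉Π)

  lineMeetsQ-G : ((x , _) (y , _) : GVert A Π) → x ≢ y → lineMeetsQ A x y ≡ 2 + 𝟙 (not (B x y))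
  lineMeetsQ-G X Y x≢y = lineMeetsQ-≡ x≢y (proj₁ (GVert-data X)) (proj₁ (GVert-data Y))
                                      (trans (proj₁ (proj₂ (GVert-data X))) (sym (proj₁ (proj₂ (GVert-data Y)))))

  lineMeetsΠ : ((x , _) (y , _) : GVert A Π) → countB π (line x y) ≡ 𝟙 (π (x ⊕ y))
  lineMeetsΠ X@(x , _) Y@(y , _) =
    trans (countB-line π x y)
          (cong₂ _+_ (cong 𝟙 (proj₂ (proj₂ (GVert-data X))))
                     (cong₂ _+_ (cong 𝟙 (proj₂ (proj₂ (GVert-data Y)))) refl))

  GAdj-elim : (X Y : GVert A Π) → GAdj A Π X Y →
              B (proj₁ X) (proj₁ Y) ≡ true ⊎ π (proj₁ X ⊕ proj₁ Y) ≡ true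
  GAdj-elim X Y (x≢y , inj₁ secant)    = inj₁ (two-points (trans (sym (lineMeetsQ-G X Y x≢y)) secant))
    where
    two-points : {b : Bool} → 2 + 𝟙 (not b) ≡ 2 → b ≡ true
    two-points {true} _ = refl
  GAdj-elim X Y (x≢y , inj₂ (_ , one)) = inj₂ (one-point (trans (sym (lineMeetsΠ X Y)) one))
    where
    one-point : {b : Bool} → 𝟙 b ≡ 1 → b ≡ true
    one-point {true} _ = refl

  GAdj-intro : (X Y : GVert A Π) → proj₁ X ≢ proj₁ Y →
               B (proj₁ X) (proj₁ Y) ≡ true ⊎ π (proj₁ X ⊕ proj₁ Y) ≡ true → GAdj A Π X Y
  GAdj-intro X@(x , _) Y@(y , _) x≢y x·y⊎x⊕y∈Π with B x y in x·y | x·y⊎x⊕y∈Π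
  ... | true  | _          = x≢y , inj₁ (trans (lineMeetsQ-G X Y x≢y) (cong (λ b → 2 + 𝟙 (not b)) x·y))
  ... | false | inj₂ x⊕y∈Π = x≢y , inj₂ (trans (lineMeetsQ-G X Y x≢y) (cong (λ b → 2 + 𝟙 (not b)) x·y) ,
                                         trans (lineMeetsΠ X Y) (cong 𝟙 x⊕y∈Π))

  GAdj-secant : (X Y : GVert A Π) → B (proj₁ X) (proj₁ Y) ≡ true → GAdj A Π X Y
  GAdj-secant X Y x·y = GAdj-intro X Y (B≡true⇒≢ x·y) (inj₁ x·y)

  ¬GAdj : (X Y : GVert A Π) → X ≢ Y → ¬ GAdj A Π X Y →
          B (proj₁ X) (proj₁ Y) ≡ false × π (proj₁ X ⊕ proj₁ Y) ≡ false
  ¬GAdj X Y X≢Y X≁Y =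
    ¬-not (X≁Y ∘ GAdj-intro X Y x≢y ∘ inj₁) , ¬-not (X≁Y ∘ GAdj-intro X Y x≢y ∘ inj₂)
    where
    x≢y : proj₁ X ≢ proj₁ Y
    x≢y = X≢Y ∘ vertex-≡

  secant-forced-by-Π : (S Z : GVert A Π) {u : V m} → GAdj A Π S Z →
                       (proj₁ S ⊕ u) ∈Π → π (proj₁ Z ⊕ u) ≡ false → B (proj₁ Z) (proj₁ S) ≡ true
  secant-forced-by-Π S@(s , _) Z@(z , _) {u} adj s⊕u∈Π z⊕u∉Π =
    [ trans (B-sym z s) , via-Π ] (GAdj-elim S Z adj)
    where
    via-Π : (s ⊕ z) ∈Π → B z s ≡ true
    via-Π s⊕z∈Π = contradiction (subst _∈Π (⊕-cancelˡ-⊕ s z u) (∈Π-⊕ s⊕z∈Π s⊕u∈Π))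
                                (λ z⊕u∈Π → true≢false (trans (sym z⊕u∈Π) z⊕u∉Π))

  secant-forced-by-B : (S Z : GVert A Π) {y : V m} → GAdj A Π S Z →
                       y ∈Π → B (proj₁ S) y ≡ false → B (proj₁ Z) y ≡ true → B (proj₁ Z) (proj₁ S) ≡ true
  secant-forced-by-B S@(s , _) Z@(z , _) {y} adj y∈Π s⊥y z·y =
    [ trans (B-sym z s) , via-Π ] (GAdj-elim S Z adj)
    where
    via-Π : (s ⊕ z) ∈Π → B z s ≡ true
    via-Π s⊕z∈Π = contradiction (trans (sym (B-⊕ˡ s z y)) (B-∈Π s⊕z∈Π y∈Π))
                                (λ eq → true≢false (trans (sym (cong₂ _xor_ s⊥y z·y)) eq))

module Configuration {n} {A : QForm m} (Π : Generator n A) (F : QuadraticForm.HyperbolicFrame A 4)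
  (g∈Π : ∀ i → Generator.π Π (QuadraticForm.HyperbolicFrame.g F i) ≡ true) where
  open QuadraticForm A
  open HyperbolicFrame F
  open Coordinates F
  open Subspace Π
  open GGraph Π
  open Generator Π using (π)

  o e₀ e₁ e₂ e₃ : V 4
  o  = zeroV
  e₀ = true  ∷ false ∷ false ∷ false ∷ []
  e₁ = false ∷ true  ∷ false ∷ false ∷ []
  e₂ = false ∷ false ∷ true  ∷ false ∷ []
  e₃ = false ∷ false ∷ false ∷ true  ∷ []

  point-∈Π : (x : V 4) → point (x , o) ∈Π
  point-∈Π x = subst _∈Π (trans (sym (⊕-identityʳ (comb g x)))
                                (cong (comb g x ⊕_) (sym (lc-false f (λ i → lookup-replicate i false)))))
                         (lc-∈Π g g∈Π (lookup x))

  point-∉Π : (a : Coord) (i : Fin 4) → lookup (proj₂ a) i ≡ true → π (point a) ≡ false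
  point-∉Π a i a·gᵢ = ∉Π-by-B (g∈Π i) (trans (B-point-g a i) a·gᵢ)

  vertex : (a : Coord) (i : Fin 4) → proj₁ a · proj₂ a ≡ false → lookup (proj₂ a) i ≡ true → GVert A Π
  vertex a i a-singular a·gᵢ =
    point a , GVert-intro {point a} (trans (Q-point a) a-singular) (point-∉Π a i a·gᵢ)

  cX cY c₁ c₀ c₂ c₃ c₂₃ : Coord
  cX  = o , e₀
  cY  = o , e₁
  c₁  = e₁ , e₀
  c₀  = e₀ , e₁
  c₂  = e₀ ⊕ e₁ , e₂
  c₃  = e₀ ⊕ e₁ , e₃
  c₂₃ = e₀ ⊕ e₁ , e₂ ⊕ e₃

  -- N₂, N₃ and N₂₃ are kept off Π by g₂ and g₃; this is where n ≥ 3 is used.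
  X Y N₁ N₀ N₂ N₃ N₂₃ : GVert A Π
  X   = vertex cX  zero                   refl refl
  Y   = vertex cY  (suc zero)             refl refl
  N₁  = vertex c₁  zero                   refl refl
  N₀  = vertex c₀  (suc zero)             refl refl
  N₂  = vertex c₂  (suc (suc zero))       refl refl
  N₃  = vertex c₃  (suc (suc (suc zero))) refl refl
  N₂₃ = vertex c₂₃ (suc (suc zero))       refl refl

  X≢Y : X ≢ Y
  X≢Y = (λ ()) ∘ point-injective cX cY ∘ cong proj₁

  X≁Y : ¬ GAdj A Π X Y
  X≁Y adj = [ (λ x·y → true≢false (trans (sym x·y) (B-point cX cY)))
            , (λ x⊕y∈Π → true≢false (trans (sym x⊕y∈Π)
                                            (trans (cong π (point-⊕ cX cY)) (point-∉Π (cX ⊞ cY) zero refl))))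
            ] (GAdj-elim X Y adj)

  N₁⊕X∈Π : (point c₁ ⊕ point cX) ∈Π
  N₁⊕X∈Π = subst _∈Π (sym (point-⊕ c₁ cX)) (point-∈Π e₁)

  N₀⊕Y∈Π : (point c₀ ⊕ point cY) ∈Π
  N₀⊕Y∈Π = subst _∈Π (sym (point-⊕ c₀ cY)) (point-∈Π e₀)

  N₁∼X : GAdj A Π N₁ X
  N₁∼X = GAdj-intro N₁ X ((λ ()) ∘ point-injective c₁ cX) (inj₂ N₁⊕X∈Π)

  N₀∼Y : GAdj A Π N₀ Y
  N₀∼Y = GAdj-intro N₀ Y ((λ ()) ∘ point-injective c₀ cY) (inj₂ N₀⊕Y∈Π)

  module _ (C : Completion (GAdj A Π) X Y) where
    open Completion C renaming (z to Z)

    private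
      z : V m
      z = proj₁ Z

    z⊥X : B z (point cX) ≡ false × π (z ⊕ point cX) ≡ false
    z⊥X = ¬GAdj Z X z≢u z≁u

    z⊥Y : B z (point cY) ≡ false × π (z ⊕ point cY) ≡ false
    z⊥Y = ¬GAdj Z Y z≢v z≁v

    z·N₁ : B z (point c₁) ≡ true
    z·N₁ = secant-forced-by-Π N₁ Z (dominates N₁ N₁∼X (GAdj-secant N₁ Y (B-point c₁ cY)))
                              N₁⊕X∈Π (proj₂ z⊥X)

    z·N₀ : B z (point c₀) ≡ true
    z·N₀ = secant-forced-by-Π N₀ Z (dominates N₀ (GAdj-secant N₀ X (B-point c₀ cX)) N₀∼Y)
                              N₀⊕Y∈Π (proj₂ z⊥Y)

    z·g₀ : B z (point (e₀ , o)) ≡ true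
    z·g₀ = trans (cong (B z) (sym (point-⊕ c₀ cY)))
                 (trans (B-⊕ʳ z (point c₀) (point cY)) (cong₂ _xor_ z·N₀ (proj₁ z⊥Y)))

    z·g₁ : B z (point (e₁ , o)) ≡ true
    z·g₁ = trans (cong (B z) (sym (point-⊕ c₁ cX)))
                 (trans (B-⊕ʳ z (point c₁) (point cX)) (cong₂ _xor_ z·N₁ (proj₁ z⊥X)))

    z·common⊥g₀ : (N : GVert A Π) → GAdj A Π N X → GAdj A Π N Y → B (proj₁ N) (point (e₀ , o)) ≡ false →
                  B z (proj₁ N) ≡ true
    z·common⊥g₀ N N∼X N∼Y N⊥g₀ = secant-forced-by-B N Z (dominates N N∼X N∼Y) (point-∈Π e₀) N⊥g₀ z·g₀

    z·N₂ : B z (point c₂) ≡ true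
    z·N₂ = z·common⊥g₀ N₂ (GAdj-secant N₂ X (B-point c₂ cX)) (GAdj-secant N₂ Y (B-point c₂ cY))
                          (B-point c₂ (e₀ , o))

    z·N₃ : B z (point c₃) ≡ true
    z·N₃ = z·common⊥g₀ N₃ (GAdj-secant N₃ X (B-point c₃ cX)) (GAdj-secant N₃ Y (B-point c₃ cY))
                          (B-point c₃ (e₀ , o))

    z·N₂₃ : B z (point c₂₃) ≡ true
    z·N₂₃ = z·common⊥g₀ N₂₃ (GAdj-secant N₂₃ X (B-point c₂₃ cX)) (GAdj-secant N₂₃ Y (B-point c₂₃ cY))
                            (B-point c₂₃ (e₀ , o))

    no-completion : ⊥
    no-completion = true≢false (begin
      true
        ≡⟨ sym (cong₂ _xor_ z·N₂ (cong₂ _xor_ z·N₃ z·N₂₃)) ⟩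
      B z (point c₂) xor (B z (point c₃) xor B z (point c₂₃))
        ≡⟨ sym (trans (B-⊕ʳ z (point c₂) _) (cong (B z (point c₂) xor_) (B-⊕ʳ z (point c₃) (point c₂₃)))) ⟩
      B z (point c₂ ⊕ (point c₃ ⊕ point c₂₃))
        ≡⟨ cong (B z) (trans (cong (point c₂ ⊕_) (point-⊕ c₃ c₂₃)) (point-⊕ c₂ (c₃ ⊞ c₂₃))) ⟩
      B z (point (e₀ ⊕ e₁ , o))
        ≡⟨ cong (B z) (sym (point-⊕ (e₀ , o) (e₁ , o))) ⟩
      B z (point (e₀ , o) ⊕ point (e₁ , o))
        ≡⟨ B-⊕ʳ z (point (e₀ , o)) (point (e₁ , o)) ⟩
      B z (point (e₀ , o)) xor B z (point (e₁ , o))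
        ≡⟨ cong₂ _xor_ z·g₀ z·g₁ ⟩
      false ∎)
      where open ≡-Reasoning

  not-completable : ¬ NonEdgesCompletable (GAdj A Π)
  not-completable complete = no-completion (complete X Y X≢Y X≁Y)

G-not-completable : {n : ℕ} {A : QForm m} → NonDegenerate A → (Π : Generator (3 + n) A) →
                    ¬ NonEdgesCompletable (GAdj A Π)
G-not-completable {n = n} {A} nd Π =
  Configuration.not-completable Π (restrict (basis-frame nd)) (λ i → basis-∈Π (i ↑ˡ n))
  where
  open QuadraticForm A
  open Subspace Π

theorem4p15 : (n : ℕ) → 3 ≤ n → (A : QForm (2 * n + 2)) → NonDegenerate A →
    (Π : Generator n A) → ¬ Isomorphic (GAdj A Π) (NOAdj A)
theorem4p15 (suc (suc (suc n))) (s≤s (s≤s (s≤s z≤n))) A nd Π G≅NO =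
  G-not-completable nd Π (completable-transport G≅NO (NOGraph.NO-completable A))
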